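{- Let $G$ be a graph and let $xy_1y_2y$ be a 2-thread of $G$ (so $d_G(y_1)=d_G(y_2)=2$, $y_1$ is adjacent to $x$ and $y_2$, and $y_2$ is adjacent to $y$), and let $m\ge 4$ be an integer. If $G-\{y_1,y_2\}$ has an equitable $m$-coloring $f$ such that $f(x)\ne f(y)$, then $f$ can be extended to an equitable $m$-coloring of $G$.
   Context: A thread in a graph is either a path whose interior vertices all have degree 2 and whose endvertices have degree at least 3, or a cycle with exactly one vertex of degree at least 3 and all other vertices of degree 2; a $k$-thread has $k$ interior vertices of degree 2. A proper vertex $m$-coloring is equitable if the sizes of any two color classes differ by at most one. Extending $f$ means finding a coloring of $G$ that agrees with $f$ on $G-\{y_1,y_2\}$. -}

module Defs where

open import Data.Nat using (ℕ; suc; _+_; _≤_)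
open import Data.Fin using (Fin)
open import Data.Fin.Properties using (_≟_)
open import Data.List using (List; length; filter)
open import Data.List.Base using (allFin)
open import Data.Product using (_×_)
open import Relation.Nullary using (¬_; Dec)
open import Relation.Nullary.Decidable using (_×-dec_; ¬?)
open import Relation.Binary.PropositionalEquality using (_≡_; _≢_)

record Graph (n : ℕ) : Set₁ where
  field
    Adj    : Fin n → Fin n → Set
    adj?   : ∀ u v → Dec (Adj u v)
    sym    : ∀ {u v} → Adj u v → Adj v u
    irrefl : ∀ {u} → ¬ Adj u u
open Graph public

deg : ∀ {n} → Graph n → Fin n → ℕ
deg G u = length (filter (adj? G u) (allFin _))

-- xy₁y₂y is a 2-thread: interior vertices y₁,y₂ have degree 2 in G,
-- the path edges x y₁, y₁ y₂, y₂ y exist, and the end vertices x, y have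
-- degree at least 3 (x = y is allowed: the cycle case of a thread).
record TwoThread {n} (G : Graph n) (x y₁ y₂ y : Fin n) : Set where
  field
    adj-xy₁  : Adj G x y₁
    adj-y₁y₂ : Adj G y₁ y₂
    adj-y₂y  : Adj G y₂ y
    deg-y₁   : deg G y₁ ≡ 2
    deg-y₂   : deg G y₂ ≡ 2
    deg-x    : 3 ≤ deg G x
    deg-y    : 3 ≤ deg G y

Kept : ∀ {n} → Fin n → Fin n → Fin n → Set
Kept y₁ y₂ v = v ≢ y₁ × v ≢ y₂

kept? : ∀ {n} (y₁ y₂ v : Fin n) → Dec (Kept y₁ y₂ v)
kept? y₁ y₂ v = ¬? (v ≟ y₁) ×-dec ¬? (v ≟ y₂)

Proper : ∀ {n m} → Graph n → (Fin n → Fin m) → Set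
Proper G f = ∀ u v → Adj G u v → f u ≢ f v

classSize : ∀ {n m} → (Fin n → Fin m) → Fin m → ℕ
classSize f c = length (filter (λ v → f v ≟ c) (allFin _))

Equitable : ∀ {n m} → Graph n → (Fin n → Fin m) → Set
Equitable G f = Proper G f × (∀ c c' → classSize f c ≤ suc (classSize f c'))

-- Colourings of G - {y₁,y₂}: a map on Fin n whose values at y₁, y₂ are ignored.
ProperMinus : ∀ {n m} → Graph n → Fin n → Fin n → (Fin n → Fin m) → Set
ProperMinus G y₁ y₂ f =
  ∀ u v → Kept y₁ y₂ u → Kept y₁ y₂ v → Adj G u v → f u ≢ f v

classSizeMinus : ∀ {n m} → Fin n → Fin n → (Fin n → Fin m) → Fin m → ℕ
classSizeMinus y₁ y₂ f c =
  length (filter (λ v → kept? y₁ y₂ v ×-dec (f v ≟ c)) (allFin _))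

EquitableMinus : ∀ {n m} → Graph n → Fin n → Fin n → (Fin n → Fin m) → Set
EquitableMinus G y₁ y₂ f =
  ProperMinus G y₁ y₂ f
  × (∀ c c' → classSizeMinus y₁ y₂ f c ≤ suc (classSizeMinus y₁ y₂ f c'))

-- Colour y₁ and y₂ with the two colours whose classes in G − {y₁, y₂} are
-- smallest, ordering them so that y₁ avoids f(x) and y₂ avoids f(y); this is
-- possible because f(x) ≠ f(y). The colouring stays proper since y₁ and y₂
-- have no neighbours besides x, y and each other, and it stays equitable
-- because exactly the two smallest classes grow, each by one.
module Submission where

open import Defs hiding (sym)
open import Data.Nat using (ℕ; zero; suc; _+_; _≤_; s≤s)
open import Data.Nat.Properties
  using (≤-trans; n≤1+n; <-irrefl; +-identityʳ; +-0-commutativeMonoid; ≤-totalOrder)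
open import Data.Fin using (Fin; punchIn; punchOut) renaming (zero to fzero; suc to fsuc)
open import Data.Fin.Properties using (_≟_; punchInᵢ≢i; punchIn-punchOut)
open import Data.Bool using (true; false; if_then_else_)
open import Data.List using (List; []; _∷_; length; filter; tabulate)
open import Data.List.Base using (allFin)
open import Data.List.Properties using (filter-≐)
open import Data.List.Membership.Propositional using (_∈_)
open import Data.List.Membership.Propositional.Properties using (∈-filter⁺; ∈-allFin)
open import Data.List.Relation.Unary.Any using (here; there)
import Data.List.Relation.Unary.All as All
open import Data.List.Extrema ≤-totalOrder using (argmin; f[argmin]≤f[xs])
open import Data.Product using (Σ; ∃₂; _×_; _,_; proj₁; proj₂)
open import Data.Sum using (_⊎_; inj₁; inj₂)
open import Relation.Nullary using (Dec; yes; no; does; contradiction; ¬?; _×-dec_)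
open import Relation.Unary using (Decidable)
open import Relation.Binary.PropositionalEquality
  using (_≡_; _≢_; refl; sym; trans; cong; cong₂; subst; subst₂; ≢-sym; module ≡-Reasoning)
open import Algebra.Properties.CommutativeMonoid.Sum +-0-commutativeMonoid
  using (sum-syntax; ∑-distrib-+; sum-cong-≗; sum-replicate-zero)

indicator : ∀ {p} {P : Set p} → Dec P → ℕ
indicator d = if does d then 1 else 0

length-filter-tabulate : ∀ {a p} {A : Set a} {P : A → Set p} (P? : Decidable P) {n}
  (h : Fin n → A) → length (filter P? (tabulate h)) ≡ ∑[ i < n ] indicator (P? (h i))
length-filter-tabulate P? {zero} h = refl
length-filter-tabulate P? {suc n} h with does (P? (h fzero))
... | true  = cong suc (length-filter-tabulate P? (λ i → h (fsuc i)))
... | false = length-filter-tabulate P? (λ i → h (fsuc i))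

∑-point : ∀ {n} (w : Fin n) (k : ℕ) → ∑[ v < n ] (if does (v ≟ w) then k else 0) ≡ k
∑-point {suc n} fzero    k = trans (cong (k +_) (sum-replicate-zero n)) (+-identityʳ k)
∑-point {suc n} (fsuc w) k = ∑-point w k

classSize-split : ∀ {n m} {y₁ y₂ : Fin n} → y₁ ≢ y₂ → (g : Fin n → Fin m) (c : Fin m) →
  classSize g c ≡
    indicator (g y₁ ≟ c) + (indicator (g y₂ ≟ c) + classSizeMinus y₁ y₂ g c)
classSize-split {n} {y₁ = y₁} {y₂} y₁≢y₂ g c = begin
  classSize g c
    ≡⟨ length-filter-tabulate (λ v → g v ≟ c) (λ v → v) ⟩
  ∑[ v < n ] indicator (g v ≟ c)
    ≡⟨ sum-cong-≗ pointwise ⟩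
  ∑[ v < n ] (at y₁ v + (at y₂ v + rest v))
    ≡⟨ ∑-distrib-+ (at y₁) (λ v → at y₂ v + rest v) ⟩
  ∑[ v < n ] at y₁ v + ∑[ v < n ] (at y₂ v + rest v)
    ≡⟨ cong (∑[ v < n ] at y₁ v +_) (∑-distrib-+ (at y₂) rest) ⟩
  ∑[ v < n ] at y₁ v + (∑[ v < n ] at y₂ v + ∑[ v < n ] rest v)
    ≡⟨ cong₂ (λ i j → i + (j + ∑[ v < n ] rest v))
             (∑-point y₁ (indicator (g y₁ ≟ c))) (∑-point y₂ (indicator (g y₂ ≟ c))) ⟩
  indicator (g y₁ ≟ c) + (indicator (g y₂ ≟ c) + ∑[ v < n ] rest v)
    ≡⟨ cong (λ i → indicator (g y₁ ≟ c) + (indicator (g y₂ ≟ c) + i))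
            (sym (length-filter-tabulate (λ v → kept? y₁ y₂ v ×-dec (g v ≟ c)) (λ v → v))) ⟩
  indicator (g y₁ ≟ c) + (indicator (g y₂ ≟ c) + classSizeMinus y₁ y₂ g c)
    ∎
  where
  open ≡-Reasoning
  at : Fin n → Fin n → ℕ
  at w v = if does (v ≟ w) then indicator (g w ≟ c) else 0
  -- kept? unfolded, so that the with in pointwise abstracts its two decisions.
  rest : Fin n → ℕ
  rest v = indicator ((¬? (v ≟ y₁) ×-dec ¬? (v ≟ y₂)) ×-dec (g v ≟ c))
  pointwise : ∀ v → indicator (g v ≟ c) ≡ at y₁ v + (at y₂ v + rest v)
  pointwise v with v ≟ y₁ | v ≟ y₂
  ... | yes refl | yes refl = contradiction refl y₁≢y₂
  ... | yes refl | no _     = sym (+-identityʳ _)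
  ... | no _     | yes refl = sym (+-identityʳ _)
  ... | no _     | no _     = refl

classSizeMinus-cong : ∀ {n m} {y₁ y₂ : Fin n} {g f : Fin n → Fin m} →
  (∀ v → Kept y₁ y₂ v → g v ≡ f v) → ∀ c → classSizeMinus y₁ y₂ g c ≡ classSizeMinus y₁ y₂ f c
classSizeMinus-cong {y₁ = y₁} {y₂} {g} {f} agree c = cong length (filter-≐
  (λ v → kept? y₁ y₂ v ×-dec (g v ≟ c)) (λ v → kept? y₁ y₂ v ×-dec (f v ≟ c))
  ((λ (kv , gv≡c) → kv , trans (sym (agree _ kv)) gv≡c) , (λ (kv , fv≡c) → kv , trans (agree _ kv) fv≡c))
  (allFin _))

SmallestPair : ∀ {m} → (Fin m → ℕ) → Fin m → Fin m → Set
SmallestPair s a b = ∀ c → c ≢ a → c ≢ b → s a ≤ s c × s b ≤ s c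

SmallestPair-swap : ∀ {m} {s : Fin m → ℕ} {a b} → SmallestPair s a b → SmallestPair s b a
SmallestPair-swap smallest c c≢b c≢a = proj₂ (smallest c c≢a c≢b) , proj₁ (smallest c c≢a c≢b)

argmin-minimal : ∀ {k} (s : Fin (suc k) → ℕ) c → s (argmin s fzero (allFin _)) ≤ s c
argmin-minimal s c = All.lookup (f[argmin]≤f[xs] {f = s} fzero (allFin _)) (∈-allFin c)

two-smallest : ∀ {j} (s : Fin (suc (suc j)) → ℕ) → ∃₂ λ p q → p ≢ q × SmallestPair s p q
two-smallest s = p , q , ≢-sym (punchInᵢ≢i p q′) , smallest
  where
  p = argmin s fzero (allFin _)
  q′ = argmin (λ i → s (punchIn p i)) fzero (allFin _)
  q = punchIn p q′
  smallest : SmallestPair s p q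
  smallest c c≢p _ = argmin-minimal s c ,
    subst (λ d → s q ≤ s d) (punchIn-punchOut (≢-sym c≢p))
      (argmin-minimal (λ i → s (punchIn p i)) (punchOut (≢-sym c≢p)))

smallest-pair-avoiding : ∀ {m} {s : Fin m → ℕ} {p q u v} → p ≢ q → SmallestPair s p q → u ≢ v →
  Σ (Fin m) λ a → Σ (Fin m) λ b → a ≢ b × a ≢ u × b ≢ v × SmallestPair s a b
smallest-pair-avoiding {p = p} {q} {u} {v} p≢q smallest u≢v with p ≟ u | q ≟ v
... | no p≢u   | no q≢v   = p , q , p≢q , p≢u , q≢v , smallest
... | yes refl | _        = q , p , ≢-sym p≢q , ≢-sym p≢q , u≢v , SmallestPair-swap smallest
... | no p≢u   | yes refl = q , p , ≢-sym p≢q , ≢-sym u≢v , p≢q , SmallestPair-swap smallest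

data BumpedSize {m} (a b : Fin m) (s : Fin m → ℕ) (c : Fin m) : ℕ → Set where
  raised    : c ≡ a ⊎ c ≡ b → BumpedSize a b s c (suc (s c))
  unchanged : c ≢ a → c ≢ b → BumpedSize a b s c (s c)

bumpedSize : ∀ {m} {a b : Fin m} (s : Fin m → ℕ) → a ≢ b → ∀ c →
  BumpedSize a b s c (indicator (a ≟ c) + (indicator (b ≟ c) + s c))
bumpedSize {a = a} {b} s a≢b c with a ≟ c | b ≟ c
... | yes refl | yes refl = contradiction refl a≢b
... | yes refl | no _     = raised (inj₁ refl)
... | no _     | yes refl = raised (inj₂ refl)
... | no a≢c   | no b≢c   = unchanged (≢-sym a≢c) (≢-sym b≢c)

bumpedSize-balanced : ∀ {m} {a b : Fin m} {s : Fin m → ℕ} →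
  (∀ c c' → s c ≤ suc (s c')) → SmallestPair s a b →
  ∀ {c c' k k'} → BumpedSize a b s c k → BumpedSize a b s c' k' → k ≤ suc k'
bumpedSize-balanced balanced _ {c} {c'} (raised _) (raised _) = s≤s (balanced c c')
bumpedSize-balanced _ smallest (raised (inj₁ refl)) (unchanged c'≢a c'≢b) =
  s≤s (proj₁ (smallest _ c'≢a c'≢b))
bumpedSize-balanced _ smallest (raised (inj₂ refl)) (unchanged c'≢a c'≢b) =
  s≤s (proj₂ (smallest _ c'≢a c'≢b))
bumpedSize-balanced balanced _ {c} {c'} (unchanged _ _) (raised _) =
  ≤-trans (balanced c c') (n≤1+n _)
bumpedSize-balanced balanced _ {c} {c'} (unchanged _ _) (unchanged _ _) = balanced c c'

∈-pair-cover : ∀ {a} {A : Set a} (xs : List A) → length xs ≡ 2 → ∀ {p q v} →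
  p ≢ q → p ∈ xs → q ∈ xs → v ∈ xs → v ≡ p ⊎ v ≡ q
∈-pair-cover (_ ∷ _ ∷ []) refl p≢q (here refl)         (here refl)         _ = contradiction refl p≢q
∈-pair-cover (_ ∷ _ ∷ []) refl p≢q (there (here refl)) (there (here refl)) _ = contradiction refl p≢q
∈-pair-cover (_ ∷ _ ∷ []) refl _   (here refl)         (there (here refl)) (here refl)         = inj₁ refl
∈-pair-cover (_ ∷ _ ∷ []) refl _   (here refl)         (there (here refl)) (there (here refl)) = inj₂ refl
∈-pair-cover (_ ∷ _ ∷ []) refl _   (there (here refl)) (here refl)         (here refl)         = inj₂ refl
∈-pair-cover (_ ∷ _ ∷ []) refl _   (there (here refl)) (here refl)         (there (here refl)) = inj₁ refl

module _ {n} (G : Graph n) where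

  adj⇒≢ : ∀ {u v} → Adj G u v → u ≢ v
  adj⇒≢ uv refl = irrefl G uv

  3≤deg-≢-deg≡2 : ∀ {u v} → 3 ≤ deg G u → deg G v ≡ 2 → u ≢ v
  3≤deg-≢-deg≡2 3≤deg deg≡2 refl = <-irrefl refl (subst (3 ≤_) deg≡2 3≤deg)

  degree-2-neighbours : ∀ {u p q v} → deg G u ≡ 2 → p ≢ q →
    Adj G u p → Adj G u q → Adj G u v → v ≡ p ⊎ v ≡ q
  degree-2-neighbours {u} deg≡2 p≢q up uq uv =
    ∈-pair-cover (filter (adj? G u) (allFin n)) deg≡2 p≢q (neighbour up) (neighbour uq) (neighbour uv)
    where
    neighbour : ∀ {w} → Adj G u w → w ∈ filter (adj? G u) (allFin n)
    neighbour uw = ∈-filter⁺ (adj? G u) (∈-allFin _) uw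

module TwoThreadProperties {n} {G : Graph n} {x y₁ y₂ y} (thread : TwoThread G x y₁ y₂ y) where
  open TwoThread thread

  y₁≢y₂ : y₁ ≢ y₂
  y₁≢y₂ = adj⇒≢ G adj-y₁y₂

  x-kept : Kept y₁ y₂ x
  x-kept = adj⇒≢ G adj-xy₁ , 3≤deg-≢-deg≡2 G deg-x deg-y₂

  y-kept : Kept y₁ y₂ y
  y-kept = 3≤deg-≢-deg≡2 G deg-y deg-y₁ , ≢-sym (adj⇒≢ G adj-y₂y)

  y₁-neighbours : ∀ {v} → Adj G y₁ v → v ≡ x ⊎ v ≡ y₂
  y₁-neighbours = degree-2-neighbours G deg-y₁ (proj₂ x-kept) (Graph.sym G adj-xy₁) adj-y₁y₂

  y₂-neighbours : ∀ {v} → Adj G y₂ v → v ≡ y₁ ⊎ v ≡ y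
  y₂-neighbours = degree-2-neighbours G deg-y₂ (≢-sym (proj₁ y-kept)) (Graph.sym G adj-y₁y₂) adj-y₂y

kept-or-removed : ∀ {n} (y₁ y₂ v : Fin n) → Kept y₁ y₂ v ⊎ (v ≡ y₁ ⊎ v ≡ y₂)
kept-or-removed y₁ y₂ v with v ≟ y₁ | v ≟ y₂
... | yes v≡y₁ | _        = inj₂ (inj₁ v≡y₁)
... | no _     | yes v≡y₂ = inj₂ (inj₂ v≡y₂)
... | no v≢y₁  | no v≢y₂  = inj₁ (v≢y₁ , v≢y₂)

module Extension {n m} {y₁ y₂ : Fin n} (y₁≢y₂ : y₁ ≢ y₂) (f : Fin n → Fin m) (a b : Fin m) where

  extend : Fin n → Fin m
  extend v with v ≟ y₁ | v ≟ y₂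
  ... | yes _ | _     = a
  ... | no _  | yes _ = b
  ... | no _  | no _  = f v

  extend-y₁ : extend y₁ ≡ a
  extend-y₁ with y₁ ≟ y₁
  ... | yes _    = refl
  ... | no y₁≢y₁ = contradiction refl y₁≢y₁

  extend-y₂ : extend y₂ ≡ b
  extend-y₂ with y₂ ≟ y₁ | y₂ ≟ y₂
  ... | yes y₂≡y₁ | _        = contradiction (sym y₂≡y₁) y₁≢y₂
  ... | no _      | yes _    = refl
  ... | no _      | no y₂≢y₂ = contradiction refl y₂≢y₂

  extend-kept : ∀ v → Kept y₁ y₂ v → extend v ≡ f v
  extend-kept v (v≢y₁ , v≢y₂) with v ≟ y₁ | v ≟ y₂
  ... | yes v≡y₁ | _        = contradiction v≡y₁ v≢y₁
  ... | no _     | yes v≡y₂ = contradiction v≡y₂ v≢y₂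
  ... | no _     | no _     = refl

  extend-classSize : ∀ c →
    classSize extend c ≡ indicator (a ≟ c) + (indicator (b ≟ c) + classSizeMinus y₁ y₂ f c)
  extend-classSize c = begin
    classSize extend c
      ≡⟨ classSize-split y₁≢y₂ extend c ⟩
    indicator (extend y₁ ≟ c) + (indicator (extend y₂ ≟ c) + classSizeMinus y₁ y₂ extend c)
      ≡⟨ cong₂ (λ i j → indicator (i ≟ c) + (indicator (j ≟ c) + classSizeMinus y₁ y₂ extend c))
               extend-y₁ extend-y₂ ⟩
    indicator (a ≟ c) + (indicator (b ≟ c) + classSizeMinus y₁ y₂ extend c)
      ≡⟨ cong (λ i → indicator (a ≟ c) + (indicator (b ≟ c) + i)) (classSizeMinus-cong extend-kept c) ⟩
    indicator (a ≟ c) + (indicator (b ≟ c) + classSizeMinus y₁ y₂ f c)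
      ∎
    where open ≡-Reasoning

  extend-balanced : (∀ c c' → classSizeMinus y₁ y₂ f c ≤ suc (classSizeMinus y₁ y₂ f c')) →
    a ≢ b → SmallestPair (classSizeMinus y₁ y₂ f) a b →
    ∀ c c' → classSize extend c ≤ suc (classSize extend c')
  extend-balanced f-balanced a≢b smallest c c' =
    subst₂ (λ k k' → k ≤ suc k') (sym (extend-classSize c)) (sym (extend-classSize c'))
      (bumpedSize-balanced f-balanced smallest (bumpedSize _ a≢b c) (bumpedSize _ a≢b c'))

  module _ {G : Graph n} {x y} (thread : TwoThread G x y₁ y₂ y) where
    open TwoThreadProperties thread using (x-kept; y-kept; y₁-neighbours; y₂-neighbours)

    module _ (a≢b : a ≢ b) (a≢fx : a ≢ f x) (b≢fy : b ≢ f y) where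

      extend-removed-≢ : ∀ {u v} → u ≡ y₁ ⊎ u ≡ y₂ → Adj G u v → extend u ≢ extend v
      extend-removed-≢ (inj₁ refl) uv with y₁-neighbours uv
      ... | inj₁ refl rewrite extend-y₁ | extend-kept x x-kept = a≢fx
      ... | inj₂ refl rewrite extend-y₁ | extend-y₂ = a≢b
      extend-removed-≢ (inj₂ refl) uv with y₂-neighbours uv
      ... | inj₁ refl rewrite extend-y₂ | extend-y₁ = ≢-sym a≢b
      ... | inj₂ refl rewrite extend-y₂ | extend-kept y y-kept = b≢fy

      extend-proper : ProperMinus G y₁ y₂ f → Proper G extend
      extend-proper f-proper u v uv with kept-or-removed y₁ y₂ u | kept-or-removed y₁ y₂ v
      ... | inj₁ u-kept | inj₁ v-kept = λ eu≡ev → f-proper u v u-kept v-kept uv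
              (trans (sym (extend-kept u u-kept)) (trans eu≡ev (extend-kept v v-kept)))
      ... | inj₁ _ | inj₂ v-removed = ≢-sym (extend-removed-≢ v-removed (Graph.sym G uv))
      ... | inj₂ u-removed | _ = extend-removed-≢ u-removed uv

equitable-extension : ∀ {n m} {G : Graph n} {x y₁ y₂ y} → TwoThread G x y₁ y₂ y →
  (f : Fin n → Fin m) → EquitableMinus G y₁ y₂ f → f x ≢ f y →
  (∃₂ λ p q → p ≢ q × SmallestPair (classSizeMinus y₁ y₂ f) p q) →
  Σ (Fin n → Fin m) (λ g → Equitable G g × (∀ v → Kept y₁ y₂ v → g v ≡ f v))
equitable-extension thread f (f-proper , f-balanced) fx≢fy (_ , _ , p≢q , smallest)
  with a , b , a≢b , a≢fx , b≢fy , ab-smallest ← smallest-pair-avoiding p≢q smallest fx≢fy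
  = extend
  , (extend-proper thread a≢b a≢fx b≢fy f-proper , extend-balanced f-balanced a≢b ab-smallest)
  , extend-kept
  where open Extension (TwoThreadProperties.y₁≢y₂ thread) f a b

lemma3p2 : ∀ {n} (G : Graph n) (x y₁ y₂ y : Fin n) (m : ℕ) →
    TwoThread G x y₁ y₂ y → 4 ≤ m →
    (f : Fin n → Fin m) → EquitableMinus G y₁ y₂ f → f x ≢ f y →
    Σ (Fin n → Fin m) (λ g →
      Equitable G g × (∀ v → Kept y₁ y₂ v → g v ≡ f v))
lemma3p2 G x y₁ y₂ y m thread (s≤s (s≤s _)) f f-equitable fx≢fy =
  equitable-extension thread f f-equitable fx≢fy (two-smallest (classSizeMinus y₁ y₂ f))
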